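{- Throw $n$ balls into $n$ bins, each ball independently and uniformly at random, and let $N_k$ be the total number of balls in the $k$ most loaded bins. For all sufficiently large $n$ and every integer $1\le k\le n/2$, $\mathbb{E}[N_k]\ge 1.5k$. -}

module Defs where

open import Data.Nat using (ℕ; zero; suc; _+_; _*_)
open import Data.Nat.Properties using (≤-decTotalOrder)
open import Data.Fin using (Fin; _≟_)
open import Data.Vec as Vec using (Vec; []; _∷_; count)
open import Data.List as List using (List; [_]; concatMap; map; allFin; take; reverse)
open import Data.Nat.ListAction using (sum)
open import Data.List.Sort ≤-decTotalOrder using (sort)

-- An outcome of throwing m balls into n bins: ball i lands in bin (lookup v i).
-- All n^m outcomes, each listed exactly once (uniform distribution).
allOutcomes : (m n : ℕ) → List (Vec (Fin n) m)
allOutcomes zero    n = [ [] ]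
allOutcomes (suc m) n = concatMap (λ b → map (b ∷_) (allOutcomes m n)) (allFin n)

load : ∀ {m n} → Vec (Fin m) n → Fin m → ℕ
load v b = count (_≟ b) v

loads : ∀ {m n} → Vec (Fin n) m → List ℕ
loads {n = n} v = map (load v) (allFin n)

topLoad : ∀ {m n} → ℕ → Vec (Fin n) m → ℕ
topLoad k v = sum (take k (reverse (sort (loads v))))

-- Sum of N_k over all n^n equally likely outcomes of n balls in n bins;
-- E[N_k] = totalTopLoad n k / n^n.
totalTopLoad : ℕ → ℕ → ℕ
totalTopLoad n k = sum (map (topLoad k) (allOutcomes n n))

module Submission where

-- Throwing n balls into n bins, the k most loaded bins hold N_k balls; for n ≥ 100 and
-- 1 ≤ k ≤ n/2 we show E[N_k] ≥ 3k/2.  Let Z be the number of empty bins and m = ⌊n/2⌋ ≥ k.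
--  1. Deterministically N_k ≥ k + min(k, Z): in the sorted loads, the top k entries either
--     carry the whole total n ≥ 2k, or are all ≥ 2, or contain the entire excess
--     Σ (load - 1), which equals Z.
--  2. Rescaling the truncation, m N_k ≥ k m + k min(m, Z), so E[N_k] ≥ k + (k/m) E[min(m, Z)].
--  3. min(m, Z) ≥ Z - Z²/(4m), and the moments E[Z] = n (1-1/n)^n and
--     E[Z²] = n(n-1)(1-2/n)^n + n(1-1/n)^n are computed exactly by writing Z as a sum of
--     products of per-ball indicators and factorising the sum over all n^n outcomes.
--  4. The estimates 0.31 ≤ (1-1/n)^n ≤ 1/2 and (1-2/n)^n ≤ (1-1/n)^{2n} give
--     E[Z²] + 2m² ≤ 4m E[Z], hence E[min(m, Z)] ≥ m/2 and E[N_k] ≥ 3k/2.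
-- Sections, in order: finite sums, top-k sums of descending lists, loads and empty bins,
-- the moments, numerical estimates, averaging.  Expectations appear as sums over allOutcomes.

open import Defs
open import Data.Nat using (ℕ; zero; suc; _+_; _*_; _∸_; _^_; _≤_; _≥_; _⊓_; ⌊_/2⌋; z≤n; s≤s; NonZero; >-nonZero; _/_; _%_)
open import Data.Nat.Properties hiding (_≟_)
open import Data.Nat.DivMod using (m≡m%n+[m/n]*n; m%n<n; m/n*n≤m)
open import Data.Nat.ListAction using (sum)
open import Data.Nat.ListAction.Properties using (sum-++; sum-↭)
open import Data.Nat.Tactic.RingSolver using (solve-∀)
open import Data.Bool using (if_then_else_)
open import Data.Empty using (⊥-elim)
open import Data.Product using (∃-syntax; _×_; _,_; proj₁; proj₂)
open import Data.Sum using (inj₁; inj₂)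
open import Data.Fin using (Fin; zero; suc; _≟_)
open import Data.Vec using (Vec; []; _∷_)
open import Data.List using (List; []; _∷_; _++_; map; take; drop; length; reverse; reverseAcc; allFin; concatMap)
import Data.List.Properties as List
open import Data.List.Relation.Unary.All as All using (All; []; _∷_)
import Data.List.Relation.Unary.All.Properties as All
open import Data.List.Relation.Unary.AllPairs using (AllPairs; []; _∷_)
open import Data.List.Sort ≤-decTotalOrder using (sort; sort-↗; sort-↭)
open import Data.List.Relation.Unary.Sorted.TotalOrder.Properties using (Sorted⇒AllPairs)
open import Data.List.Relation.Binary.Permutation.Propositional using (_↭_; ↭-trans)
open import Data.List.Relation.Binary.Permutation.Propositional.Properties using (↭-reverse; ↭-length; map⁺)
open import Relation.Binary.Bundles using (DecTotalOrder)
open import Relation.Nullary using (does; yes; no)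
open import Relation.Binary.PropositionalEquality
open import Function using (_∘_)

module _ {A : Set} where

  Σ[_]_ : List A → (A → ℕ) → ℕ
  Σ[ l ] f = sum (map f l)

  Σ-cong : ∀ (l : List A) {f g : A → ℕ} → (∀ x → f x ≡ g x) → Σ[ l ] f ≡ Σ[ l ] g
  Σ-cong l f≗g = cong sum (List.map-cong f≗g l)

  Σ-mono : ∀ (l : List A) {f g : A → ℕ} → (∀ x → f x ≤ g x) → Σ[ l ] f ≤ Σ[ l ] g
  Σ-mono []      f≤g = z≤n
  Σ-mono (x ∷ l) f≤g = +-mono-≤ (f≤g x) (Σ-mono l f≤g)

  Σ-const : ∀ (l : List A) c → Σ[ l ] (λ _ → c) ≡ length l * c
  Σ-const []      c = refl
  Σ-const (x ∷ l) c = cong (c +_) (Σ-const l c)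

  Σ-zero : ∀ (l : List A) → Σ[ l ] (λ _ → 0) ≡ 0
  Σ-zero l = trans (Σ-const l 0) (*-zeroʳ (length l))

  Σ-+ : ∀ (l : List A) (f g : A → ℕ) → Σ[ l ] (λ x → f x + g x) ≡ Σ[ l ] f + Σ[ l ] g
  Σ-+ []      f g = refl
  Σ-+ (x ∷ l) f g = trans (cong (f x + g x +_) (Σ-+ l f g)) (interchange (f x) (g x) _ _)
    where
    interchange : ∀ a b c d → a + b + (c + d) ≡ a + c + (b + d)
    interchange = solve-∀

  Σ-*ˡ : ∀ (l : List A) c (f : A → ℕ) → Σ[ l ] (λ x → c * f x) ≡ c * Σ[ l ] f
  Σ-*ˡ []      c f = sym (*-zeroʳ c)
  Σ-*ˡ (x ∷ l) c f = trans (cong (c * f x +_) (Σ-*ˡ l c f)) (sym (*-distribˡ-+ c (f x) _))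

  Σ-*ʳ : ∀ (l : List A) c (f : A → ℕ) → Σ[ l ] (λ x → f x * c) ≡ Σ[ l ] f * c
  Σ-*ʳ l c f = trans (Σ-cong l (λ x → *-comm (f x) c)) (trans (Σ-*ˡ l c f) (*-comm c _))

  Σ-++ : ∀ (l l′ : List A) f → Σ[ l ++ l′ ] f ≡ Σ[ l ] f + Σ[ l′ ] f
  Σ-++ l l′ f = trans (cong sum (List.map-++ f l l′)) (sum-++ (map f l) (map f l′))

  Σ-mul : ∀ (l : List A) (f g : A → ℕ) → Σ[ l ] f * Σ[ l ] g ≡ Σ[ l ] (λ x → Σ[ l ] (λ y → f x * g y))
  Σ-mul l f g = trans (sym (Σ-*ʳ l (Σ[ l ] g) f)) (Σ-cong l (λ x → sym (Σ-*ˡ l (f x) g)))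

module _ {A B : Set} where

  Σ-swap : ∀ (l : List A) (l′ : List B) (g : A → B → ℕ) →
           Σ[ l ] (λ x → Σ[ l′ ] (g x)) ≡ Σ[ l′ ] (λ y → Σ[ l ] (λ x → g x y))
  Σ-swap []      l′ g = sym (Σ-zero l′)
  Σ-swap (x ∷ l) l′ g =
    trans (cong (Σ[ l′ ] (g x) +_) (Σ-swap l l′ g)) (sym (Σ-+ l′ (g x) (λ y → Σ[ l ] (λ x → g x y))))

  Σ-map : ∀ (l : List A) (h : A → B) (f : B → ℕ) → Σ[ map h l ] f ≡ Σ[ l ] (f ∘ h)
  Σ-map l h f = cong sum (sym (List.map-∘ l))

  Σ-concatMap : ∀ (l : List A) (h : A → List B) (f : B → ℕ) →
                Σ[ concatMap h l ] f ≡ Σ[ l ] (λ x → Σ[ h x ] f)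
  Σ-concatMap []      h f = refl
  Σ-concatMap (x ∷ l) h f = trans (Σ-++ (h x) (concatMap h l) f) (cong (Σ[ h x ] f +_) (Σ-concatMap l h f))

Σ-allFin-suc : ∀ {n} (f : Fin (suc n) → ℕ) → Σ[ allFin (suc n) ] f ≡ f zero + Σ[ allFin n ] (f ∘ suc)
Σ-allFin-suc {n} f = trans (cong sum (List.map-tabulate (λ x → x) f))
                            (cong (f zero +_) (sym (cong sum (List.map-tabulate {n = n} (λ x → x) (f ∘ suc)))))

Σ-allFin-const : ∀ n c → Σ[ allFin n ] (λ _ → c) ≡ n * c
Σ-allFin-const n c = trans (Σ-const (allFin n) c) (cong (_* c) (List.length-tabulate {n = n} (λ x → x)))

Descending : List ℕ → Set
Descending = AllPairs _≥_

reverseAcc-descending : ∀ acc zs → AllPairs _≤_ zs → Descending acc → All (λ a → All (a ≤_) zs) acc →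
                        Descending (reverseAcc acc zs)
reverseAcc-descending acc []       _           acc↓ _      = acc↓
reverseAcc-descending acc (z ∷ zs) (z≤zs ∷ zs↑) acc↓ acc≤zs =
  reverseAcc-descending (z ∷ acc) zs zs↑ (All.map All.head acc≤zs ∷ acc↓) (z≤zs ∷ All.map All.tail acc≤zs)

sort-descending : ∀ xs → Descending (reverse (sort xs))
sort-descending xs =
  reverseAcc-descending [] (sort xs) (Sorted⇒AllPairs (DecTotalOrder.totalOrder ≤-decTotalOrder) (sort-↗ xs)) [] []

-- The first entry of a list, 0 for the empty list.  For a descending list ys,
-- headOr0 (drop k ys) is the (k+1)-st largest entry: the threshold separating the top k.
headOr0 : List ℕ → ℕ
headOr0 []      = 0
headOr0 (y ∷ _) = y

headOr0-≤ : ∀ {y} ws → All (_≤ y) ws → headOr0 ws ≤ y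
headOr0-≤ []       []      = z≤n
headOr0-≤ (w ∷ ws) (w≤y ∷ _) = w≤y

threshold-split : ∀ {ys} → Descending ys → ∀ k →
                  All (headOr0 (drop k ys) ≤_) (take k ys) × All (_≤ headOr0 (drop k ys)) (drop k ys)
threshold-split []         zero    = [] , []
threshold-split (y≥ys ∷ _) zero    = [] , (≤-refl ∷ y≥ys)
threshold-split []         (suc k) = [] , []
threshold-split {y ∷ ys} (y≥ys ∷ ys↓) (suc k) with threshold-split ys↓ k
... | above , below = headOr0-≤ (drop k ys) (All.drop⁺ k y≥ys) ∷ above , below

sum-above : ∀ t as → All (t ≤_) as → sum as ≡ length as * t + Σ[ as ] (_∸ t)
sum-above t []       []          = refl
sum-above t (a ∷ as) (t≤a ∷ t≤as) = begin
  a + sum as                                    ≡⟨ cong₂ _+_ (sym (m+[n∸m]≡n t≤a)) (sum-above t as t≤as) ⟩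
  (t + (a ∸ t)) + (length as * t + Σ[ as ] (_∸ t)) ≡⟨ regroup t (a ∸ t) (length as) (Σ[ as ] (_∸ t)) ⟩
  (t + length as * t) + ((a ∸ t) + Σ[ as ] (_∸ t)) ∎
  where
  open ≡-Reasoning
  regroup : ∀ t u l s → (t + u) + (l * t + s) ≡ (t + l * t) + (u + s)
  regroup = solve-∀

excess-below : ∀ t bs → All (_≤ t) bs → Σ[ bs ] (_∸ t) ≡ 0
excess-below t []       []          = refl
excess-below t (b ∷ bs) (b≤t ∷ bs≤t) = cong₂ _+_ (m≤n⇒m∸n≡0 b≤t) (excess-below t bs bs≤t)

top-sum : ∀ {ys} → Descending ys → ∀ k → k ≤ length ys →
          sum (take k ys) ≡ k * headOr0 (drop k ys) + Σ[ ys ] (_∸ headOr0 (drop k ys))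
top-sum {ys} ys↓ k k≤len = begin
  sum (take k ys)                                               ≡⟨ sum-above t (take k ys) above ⟩
  length (take k ys) * t + Σ[ take k ys ] (_∸ t)                  ≡⟨ cong₂ _+_ (cong (_* t) length-top) (sym (+-identityʳ _)) ⟩
  k * t + (Σ[ take k ys ] (_∸ t) + 0)                             ≡⟨ cong (λ z → k * t + (Σ[ take k ys ] (_∸ t) + z)) (sym (excess-below t (drop k ys) below)) ⟩
  k * t + (Σ[ take k ys ] (_∸ t) + Σ[ drop k ys ] (_∸ t))          ≡⟨ cong (k * t +_) (sym (Σ-++ (take k ys) (drop k ys) (_∸ t))) ⟩
  k * t + Σ[ take k ys ++ drop k ys ] (_∸ t)                       ≡⟨ cong (λ zs → k * t + Σ[ zs ] (_∸ t)) (List.take++drop≡id k ys) ⟩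
  k * t + Σ[ ys ] (_∸ t)                                          ∎
  where
  open ≡-Reasoning
  t = headOr0 (drop k ys)
  above = proj₁ (threshold-split ys↓ k)
  below = proj₂ (threshold-split ys↓ k)
  length-top : length (take k ys) ≡ k
  length-top = trans (List.length-take k ys) (m≤n⇒m⊓n≡m k≤len)

-- Key deterministic bound: if a descending list of length ≥ k has sum ≥ 2k, its
-- k largest entries sum to at least k + min(k, E), where E = Σ (y ∸ 1) is its
-- excess over 1.  Case on the threshold t: for t = 0 the top k carry the whole
-- sum, for t = 1 the top-k sum is exactly k + E, and for t ≥ 2 it is ≥ 2k.
top-sum-bound : ∀ {ys} → Descending ys → ∀ k → k ≤ length ys → k + k ≤ sum ys →
                k + k ⊓ Σ[ ys ] (_∸ 1) ≤ sum (take k ys)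
top-sum-bound {ys} ys↓ k k≤len k+k≤sum with headOr0 (drop k ys) | top-sum ys↓ k k≤len
... | zero | top≡ = begin
  k + k ⊓ E              ≤⟨ +-monoʳ-≤ k (m⊓n≤m k E) ⟩
  k + k                  ≤⟨ k+k≤sum ⟩
  sum ys                 ≡⟨ cong sum (sym (List.map-id ys)) ⟩
  Σ[ ys ] (_∸ 0)         ≡⟨ cong (_+ Σ[ ys ] (_∸ 0)) (sym (*-zeroʳ k)) ⟩
  k * 0 + Σ[ ys ] (_∸ 0) ≡⟨ sym top≡ ⟩
  sum (take k ys)        ∎
  where
  open ≤-Reasoning
  E = Σ[ ys ] (_∸ 1)
... | suc zero | top≡ = begin
  k + k ⊓ E        ≤⟨ +-monoʳ-≤ k (m⊓n≤n k E) ⟩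
  k + E            ≡⟨ cong (_+ E) (sym (*-identityʳ k)) ⟩
  k * 1 + E        ≡⟨ sym top≡ ⟩
  sum (take k ys)  ∎
  where
  open ≤-Reasoning
  E = Σ[ ys ] (_∸ 1)
... | suc (suc t) | top≡ = begin
  k + k ⊓ Σ[ ys ] (_∸ 1) ≤⟨ +-monoʳ-≤ k (m⊓n≤m k _) ⟩
  k + k                  ≡⟨ cong (k +_) (sym (*-identityʳ k)) ⟩
  k + k * 1              ≡⟨ sym (*-suc k 1) ⟩
  k * 2                  ≤⟨ *-monoʳ-≤ k (s≤s (s≤s z≤n)) ⟩
  k * suc (suc t)        ≤⟨ m≤m+n _ _ ⟩
  k * suc (suc t) + _    ≡⟨ sym top≡ ⟩
  sum (take k ys)        ∎
  where open ≤-Reasoning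

δ : ∀ {n} → Fin n → Fin n → ℕ
δ x b = if does (x ≟ b) then 1 else 0

δ̄ : ∀ {n} → Fin n → Fin n → ℕ
δ̄ x b = if does (x ≟ b) then 0 else 1

δ-sym : ∀ {n} (x b : Fin n) → δ x b ≡ δ b x
δ-sym x b with x ≟ b | b ≟ x
... | yes _ | yes _ = refl
... | no _  | no _  = refl
... | yes x≡b | no b≢x = ⊥-elim (b≢x (sym x≡b))
... | no x≢b | yes b≡x = ⊥-elim (x≢b (sym b≡x))

δ+δ̄ : ∀ {n} (x b : Fin n) → δ x b + δ̄ x b ≡ 1
δ+δ̄ x b with x ≟ b
... | yes _ = refl
... | no _  = refl

Σ-δ : ∀ {n} (x : Fin n) → Σ[ allFin n ] (δ x) ≡ 1
Σ-δ {suc n} zero    = trans (Σ-allFin-suc {n} (δ zero)) (cong suc (Σ-zero (allFin n)))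
Σ-δ {suc n} (suc x) = trans (Σ-allFin-suc {n} (δ (suc x))) (Σ-δ x)

Σ-δ̄ : ∀ {n} (b : Fin n) → Σ[ allFin n ] (λ x → δ̄ x b) + 1 ≡ n
Σ-δ̄ {n} b = begin
  Σ[ L ] (λ x → δ̄ x b) + 1                       ≡⟨ cong (Σ[ L ] (λ x → δ̄ x b) +_) (sym Σ-δ-b) ⟩
  Σ[ L ] (λ x → δ̄ x b) + Σ[ L ] (λ x → δ x b)     ≡⟨ sym (Σ-+ L _ _) ⟩
  Σ[ L ] (λ x → δ̄ x b + δ x b)                   ≡⟨ Σ-cong L (λ x → trans (+-comm (δ̄ x b) _) (δ+δ̄ x b)) ⟩
  Σ[ L ] (λ _ → 1)                               ≡⟨ trans (Σ-allFin-const n 1) (*-identityʳ n) ⟩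
  n                                              ∎
  where
  open ≡-Reasoning
  L = allFin n
  Σ-δ-b : Σ[ L ] (λ x → δ x b) ≡ 1
  Σ-δ-b = trans (Σ-cong L (λ x → δ-sym x b)) (Σ-δ b)

load-∷ : ∀ {n m} (x b : Fin n) (v : Vec (Fin n) m) → load (x ∷ v) b ≡ δ x b + load v b
load-∷ x b v with x ≟ b
... | yes _ = refl
... | no _  = refl

sum-loads : ∀ {n m} (v : Vec (Fin n) m) → sum (loads v) ≡ m
sum-loads {n} []      = Σ-zero (allFin n)
sum-loads {n} (x ∷ v) = begin
  Σ[ allFin n ] (load (x ∷ v))                       ≡⟨ Σ-cong (allFin n) (λ b → load-∷ x b v) ⟩
  Σ[ allFin n ] (λ b → δ x b + load v b)             ≡⟨ Σ-+ (allFin n) (δ x) (load v) ⟩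
  Σ[ allFin n ] (δ x) + Σ[ allFin n ] (load v)       ≡⟨ cong₂ _+_ (Σ-δ x) (sum-loads v) ⟩
  suc _                                             ∎
  where open ≡-Reasoning

length-loads : ∀ {n m} (v : Vec (Fin n) m) → length (loads v) ≡ n
length-loads {n} v = trans (List.length-map (load v) (allFin n)) (List.length-tabulate (λ x → x))

isZero : ℕ → ℕ
isZero zero    = 1
isZero (suc _) = 0

emptyBins : ∀ {n m} → Vec (Fin n) m → ℕ
emptyBins v = Σ[ loads v ] isZero

-- Σ (x ∸ 1) + #entries = Σ x + #zero entries, since x ∸ 1 + 1 = x + [x = 0].
excess-+-length : ∀ (xs : List ℕ) → Σ[ xs ] (_∸ 1) + length xs ≡ sum xs + Σ[ xs ] isZero
excess-+-length []           = refl
excess-+-length (zero  ∷ xs) = trans (+-suc _ _) (trans (cong suc (excess-+-length xs)) (sym (+-suc _ _)))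
excess-+-length (suc x ∷ xs) = begin
  x + Σ[ xs ] (_∸ 1) + suc (length xs)    ≡⟨ +-suc (x + Σ[ xs ] (_∸ 1)) _ ⟩
  suc (x + Σ[ xs ] (_∸ 1) + length xs)    ≡⟨ cong suc (+-assoc x _ _) ⟩
  suc (x + (Σ[ xs ] (_∸ 1) + length xs))  ≡⟨ cong (λ e → suc (x + e)) (excess-+-length xs) ⟩
  suc (x + (sum xs + Σ[ xs ] isZero))     ≡⟨ cong suc (sym (+-assoc x _ _)) ⟩
  suc x + sum xs + Σ[ xs ] isZero         ∎
  where open ≡-Reasoning

excess-loads : ∀ {n} (v : Vec (Fin n) n) → Σ[ loads v ] (_∸ 1) ≡ emptyBins v
excess-loads {n} v = +-cancelʳ-≡ n _ _ (begin
  Σ[ xs ] (_∸ 1) + n             ≡⟨ cong (Σ[ xs ] (_∸ 1) +_) (sym (length-loads v)) ⟩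
  Σ[ xs ] (_∸ 1) + length xs     ≡⟨ excess-+-length xs ⟩
  sum xs + emptyBins v           ≡⟨ cong (_+ emptyBins v) (sum-loads v) ⟩
  n + emptyBins v                ≡⟨ +-comm n _ ⟩
  emptyBins v + n                ∎)
  where
  open ≡-Reasoning
  xs = loads v

topLoad-bound : ∀ {n} (v : Vec (Fin n) n) k → k + k ≤ n → k + k ⊓ emptyBins v ≤ topLoad k v
topLoad-bound {n} v k k+k≤n =
  subst (λ e → k + k ⊓ e ≤ topLoad k v) excess≡ (top-sum-bound (sort-descending xs) k k≤len k+k≤sum)
  where
  xs = loads v
  ys = reverse (sort xs)
  ys↭xs : ys ↭ xs
  ys↭xs = ↭-trans (↭-reverse (sort xs)) (sort-↭ xs)
  k+k≤sum : k + k ≤ sum ys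
  k+k≤sum = ≤-trans k+k≤n (≤-reflexive (sym (trans (sum-↭ ys↭xs) (sum-loads v))))
  k≤len : k ≤ length ys
  k≤len = ≤-trans (m≤m+n k k) (≤-trans k+k≤n (≤-reflexive (sym (trans (↭-length ys↭xs) (length-loads v)))))
  excess≡ : Σ[ ys ] (_∸ 1) ≡ emptyBins v
  excess≡ = trans (sum-↭ (map⁺ (_∸ 1) ys↭xs)) (excess-loads v)

∏ : ∀ {n m} → (Fin n → ℕ) → Vec (Fin n) m → ℕ
∏ f []      = 1
∏ f (x ∷ v) = f x * ∏ f v

∏-* : ∀ {n m} (f g : Fin n → ℕ) (v : Vec (Fin n) m) → ∏ f v * ∏ g v ≡ ∏ (λ c → f c * g c) v
∏-* f g []      = refl
∏-* f g (x ∷ v) = trans (regroup (f x) (g x) (∏ f v) (∏ g v)) (cong (f x * g x *_) (∏-* f g v))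
  where
  regroup : ∀ a b c d → a * c * (b * d) ≡ a * b * (c * d)
  regroup = solve-∀

-- Balls are thrown independently: summing a per-ball product over all n^m
-- outcomes factorises into the m-th power of a single-ball sum.
Σ-outcomes-∏ : ∀ m n (f : Fin n → ℕ) → Σ[ allOutcomes m n ] (∏ f) ≡ (Σ[ allFin n ] f) ^ m
Σ-outcomes-∏ zero    n f = refl
Σ-outcomes-∏ (suc m) n f = begin
  Σ[ allOutcomes (suc m) n ] (∏ f)                              ≡⟨ Σ-concatMap (allFin n) (λ b → map (b ∷_) O) (∏ f) ⟩
  Σ[ allFin n ] (λ b → Σ[ map (b ∷_) O ] (∏ f))                 ≡⟨ Σ-cong (allFin n) (λ b → Σ-map O (b ∷_) (∏ f)) ⟩
  Σ[ allFin n ] (λ b → Σ[ O ] (λ w → f b * ∏ f w))              ≡⟨ Σ-cong (allFin n) (λ b → Σ-*ˡ O (f b) (∏ f)) ⟩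
  Σ[ allFin n ] (λ b → f b * Σ[ O ] (∏ f))                      ≡⟨ Σ-*ʳ (allFin n) _ f ⟩
  Σ[ allFin n ] f * Σ[ O ] (∏ f)                                ≡⟨ cong (Σ[ allFin n ] f *_) (Σ-outcomes-∏ m n f) ⟩
  Σ[ allFin n ] f * (Σ[ allFin n ] f) ^ m                       ∎
  where
  open ≡-Reasoning
  O = allOutcomes m n

∏-one : ∀ {n m} (v : Vec (Fin n) m) → ∏ (λ _ → 1) v ≡ 1
∏-one []      = refl
∏-one (x ∷ v) = trans (+-identityʳ _) (∏-one v)

Σ-outcomes-const : ∀ m n c → Σ[ allOutcomes m n ] (λ _ → c) ≡ c * n ^ m
Σ-outcomes-const m n c = begin
  Σ[ O ] (λ _ → c)                 ≡⟨ Σ-cong O (λ v → sym (trans (cong (c *_) (∏-one v)) (*-identityʳ c))) ⟩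
  Σ[ O ] (λ v → c * ∏ (λ _ → 1) v) ≡⟨ Σ-*ˡ O c _ ⟩
  c * Σ[ O ] (∏ (λ _ → 1))         ≡⟨ cong (c *_) (Σ-outcomes-∏ m n (λ _ → 1)) ⟩
  c * (Σ[ allFin n ] (λ _ → 1)) ^ m ≡⟨ cong (λ s → c * s ^ m) (trans (Σ-allFin-const n 1) (*-identityʳ n)) ⟩
  c * n ^ m                        ∎
  where
  open ≡-Reasoning
  O = allOutcomes m n

isZero-load : ∀ {n m} (b : Fin n) (v : Vec (Fin n) m) → isZero (load v b) ≡ ∏ (λ c → δ̄ c b) v
isZero-load b []      = refl
isZero-load b (x ∷ v) with x ≟ b
... | yes _ = refl
... | no _  = trans (isZero-load b v) (sym (+-identityʳ _))

emptyBins-∏ : ∀ {n m} (v : Vec (Fin n) m) → emptyBins v ≡ Σ[ allFin n ] (λ b → ∏ (λ c → δ̄ c b) v)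
emptyBins-∏ {n} v = trans (Σ-map (allFin n) (load v) isZero) (Σ-cong (allFin n) (λ b → isZero-load b v))

first-moment : ∀ m n → Σ[ allOutcomes m n ] emptyBins ≡ n * (n ∸ 1) ^ m
first-moment m n = begin
  Σ[ O ] emptyBins                                     ≡⟨ Σ-cong O emptyBins-∏ ⟩
  Σ[ O ] (λ v → Σ[ L ] (λ b → ∏ (λ c → δ̄ c b) v))     ≡⟨ Σ-swap O L _ ⟩
  Σ[ L ] (λ b → Σ[ O ] (∏ (λ c → δ̄ c b)))             ≡⟨ Σ-cong L (λ b → Σ-outcomes-∏ m n (λ c → δ̄ c b)) ⟩
  Σ[ L ] (λ b → (Σ[ L ] (λ c → δ̄ c b)) ^ m)           ≡⟨ Σ-cong L (λ b → cong (_^ m) (avoiders b)) ⟩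
  Σ[ L ] (λ _ → (n ∸ 1) ^ m)                          ≡⟨ Σ-allFin-const n _ ⟩
  n * (n ∸ 1) ^ m                                     ∎
  where
  open ≡-Reasoning
  O = allOutcomes m n
  L = allFin n
  avoiders : ∀ b → Σ[ L ] (λ c → δ̄ c b) ≡ n ∸ 1
  avoiders b = trans (sym (m+n∸n≡m _ 1)) (cong (_∸ 1) (Σ-δ̄ b))

-- Pointwise count behind the pair count below: c avoids both b and b′, or
-- c hits b, or c hits b′, with the double hit (only possible if b = b′) counted twice.
avoid-both : ∀ {n} (c b b′ : Fin n) → δ̄ c b * δ̄ c b′ + δ c b + δ c b′ ≡ 1 + δ c b * δ b b′
avoid-both c b b′ with c ≟ b | c ≟ b′ | b ≟ b′
... | yes c≡b | yes c≡b′ | no b≢b′ = ⊥-elim (b≢b′ (trans (sym c≡b) c≡b′))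
... | yes c≡b | no c≢b′  | yes b≡b′ = ⊥-elim (c≢b′ (trans c≡b b≡b′))
... | yes _ | yes _ | yes _ = refl
... | yes _ | no _  | no _  = refl
... | no _  | yes _ | yes _ = refl
... | no _  | yes _ | no _  = refl
... | no _  | no _  | yes _ = refl
... | no _  | no _  | no _  = refl

Σ-avoid-both : ∀ {n} (b b′ : Fin n) → Σ[ allFin n ] (λ c → δ̄ c b * δ̄ c b′) + 1 + 1 ≡ n + δ b b′
Σ-avoid-both {n} b b′ = begin
  P + 1 + 1                                       ≡⟨ cong₂ (λ x y → P + x + y) (sym (hits b)) (sym (hits b′)) ⟩
  P + Σ[ L ] (λ c → δ c b) + Σ[ L ] (λ c → δ c b′)  ≡⟨ cong (_+ Σ[ L ] (λ c → δ c b′)) (sym (Σ-+ L _ _)) ⟩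
  Σ[ L ] (λ c → δ̄ c b * δ̄ c b′ + δ c b) + Σ[ L ] (λ c → δ c b′) ≡⟨ sym (Σ-+ L _ _) ⟩
  Σ[ L ] (λ c → δ̄ c b * δ̄ c b′ + δ c b + δ c b′)  ≡⟨ Σ-cong L (λ c → avoid-both c b b′) ⟩
  Σ[ L ] (λ c → 1 + δ c b * δ b b′)               ≡⟨ Σ-+ L _ _ ⟩
  Σ[ L ] (λ _ → 1) + Σ[ L ] (λ c → δ c b * δ b b′) ≡⟨ cong₂ _+_ (trans (Σ-allFin-const n 1) (*-identityʳ n)) (Σ-*ʳ L (δ b b′) (λ c → δ c b)) ⟩
  n + Σ[ L ] (λ c → δ c b) * δ b b′               ≡⟨ cong (λ x → n + x * δ b b′) (hits b) ⟩
  n + 1 * δ b b′                                  ≡⟨ cong (n +_) (*-identityˡ _) ⟩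
  n + δ b b′                                      ∎
  where
  open ≡-Reasoning
  L = allFin n
  P = Σ[ L ] (λ c → δ̄ c b * δ̄ c b′)
  hits : ∀ b → Σ[ L ] (λ c → δ c b) ≡ 1
  hits b = trans (Σ-cong L (λ c → δ-sym c b)) (Σ-δ b)

-- The number X of outcomes leaving both b and b′ empty, (number of bins avoiding both)^m,
-- is (n-1)^m if b = b′ and (n-2)^m otherwise; without case distinction:
-- X + [b = b′]·(n-2)^m = (n-2)^m + [b = b′]·(n-1)^m.
both-empty : ∀ {n} m (b b′ : Fin n) →
             (Σ[ allFin n ] (λ c → δ̄ c b * δ̄ c b′)) ^ m + δ b b′ * (n ∸ 2) ^ m ≡ (n ∸ 2) ^ m + δ b b′ * (n ∸ 1) ^ m
both-empty {n} m b b′ with b ≟ b′ | Σ-avoid-both b b′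
... | yes _ | count≡ = trans (cong (λ z → z ^ m + 1 * (n ∸ 2) ^ m) P≡) (swap ((n ∸ 1) ^ m) ((n ∸ 2) ^ m))
  where
  P = Σ[ allFin n ] (λ c → δ̄ c b * δ̄ c b′)
  P≡ : P ≡ n ∸ 1
  P≡ = trans (sym (m+n∸n≡m P 2)) (cong (_∸ 2) (trans (sym (+-assoc P 1 1)) (trans count≡ (+-comm n 1))))
  swap : ∀ x y → x + 1 * y ≡ y + 1 * x
  swap = solve-∀
... | no _  | count≡ = cong (λ z → z ^ m + 0) P≡
  where
  P = Σ[ allFin n ] (λ c → δ̄ c b * δ̄ c b′)
  P≡ : P ≡ n ∸ 2
  P≡ = trans (sym (m+n∸n≡m P 2)) (cong (_∸ 2) (trans (sym (+-assoc P 1 1)) (trans count≡ (+-identityʳ n))))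

Σ-δ-* : ∀ {n} (b : Fin n) K → Σ[ allFin n ] (λ b′ → δ b b′ * K) ≡ K
Σ-δ-* {n} b K = trans (Σ-*ʳ (allFin n) K (δ b)) (trans (cong (_* K) (Σ-δ b)) (*-identityˡ K))

both-empty-row : ∀ {n} m (b : Fin n) →
                 Σ[ allFin n ] (λ b′ → (Σ[ allFin n ] (λ c → δ̄ c b * δ̄ c b′)) ^ m) + (n ∸ 2) ^ m
                 ≡ n * (n ∸ 2) ^ m + (n ∸ 1) ^ m
both-empty-row {n} m b = begin
  Σ[ L ] X + B                              ≡⟨ cong (Σ[ L ] X +_) (sym (Σ-δ-* b B)) ⟩
  Σ[ L ] X + Σ[ L ] (λ b′ → δ b b′ * B)     ≡⟨ sym (Σ-+ L _ _) ⟩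
  Σ[ L ] (λ b′ → X b′ + δ b b′ * B)         ≡⟨ Σ-cong L (both-empty m b) ⟩
  Σ[ L ] (λ b′ → B + δ b b′ * A)            ≡⟨ Σ-+ L _ _ ⟩
  Σ[ L ] (λ _ → B) + Σ[ L ] (λ b′ → δ b b′ * A) ≡⟨ cong₂ _+_ (Σ-allFin-const n B) (Σ-δ-* b A) ⟩
  n * B + A                                 ∎
  where
  open ≡-Reasoning
  L = allFin n
  A = (n ∸ 1) ^ m
  B = (n ∸ 2) ^ m
  X = λ b′ → (Σ[ allFin n ] (λ c → δ̄ c b * δ̄ c b′)) ^ m

second-moment : ∀ m n → Σ[ allOutcomes m n ] (λ v → emptyBins v * emptyBins v) + n * (n ∸ 2) ^ m
                        ≡ n * (n * (n ∸ 2) ^ m + (n ∸ 1) ^ m)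
second-moment m n = begin
  Σ[ O ] (λ v → emptyBins v * emptyBins v) + n * B ≡⟨ cong (_+ n * B) pairs ⟩
  Σ[ L ] X + n * B                          ≡⟨ cong (Σ[ L ] X +_) (sym (Σ-allFin-const n B)) ⟩
  Σ[ L ] X + Σ[ L ] (λ _ → B)               ≡⟨ sym (Σ-+ L _ _) ⟩
  Σ[ L ] (λ b → X b + B)                    ≡⟨ Σ-cong L (both-empty-row m) ⟩
  Σ[ L ] (λ b → n * B + A)                  ≡⟨ Σ-allFin-const n _ ⟩
  n * (n * B + A)                           ∎
  where
  open ≡-Reasoning
  O = allOutcomes m n
  L = allFin n
  A = (n ∸ 1) ^ m
  B = (n ∸ 2) ^ m
  X = λ b → Σ[ L ] (λ b′ → (Σ[ L ] (λ c → δ̄ c b * δ̄ c b′)) ^ m)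
  Q = λ b b′ v → ∏ (λ c → δ̄ c b * δ̄ c b′) v
  -- Z² = Σ_{b,b′} [b and b′ both empty], then sum over outcomes first.
  pairs : Σ[ O ] (λ v → emptyBins v * emptyBins v) ≡ Σ[ L ] X
  pairs = begin
    Σ[ O ] (λ v → emptyBins v * emptyBins v)
      ≡⟨ Σ-cong O (λ v → trans (cong₂ _*_ (emptyBins-∏ v) (emptyBins-∏ v)) (Σ-mul L _ _)) ⟩
    Σ[ O ] (λ v → Σ[ L ] (λ b → Σ[ L ] (λ b′ → ∏ (λ c → δ̄ c b) v * ∏ (λ c → δ̄ c b′) v)))
      ≡⟨ Σ-cong O (λ v → Σ-cong L (λ b → Σ-cong L (λ b′ → ∏-* _ _ v))) ⟩
    Σ[ O ] (λ v → Σ[ L ] (λ b → Σ[ L ] (λ b′ → Q b b′ v)))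
      ≡⟨ Σ-swap O L _ ⟩
    Σ[ L ] (λ b → Σ[ O ] (λ v → Σ[ L ] (λ b′ → Q b b′ v)))
      ≡⟨ Σ-cong L (λ b → Σ-swap O L _) ⟩
    Σ[ L ] (λ b → Σ[ L ] (λ b′ → Σ[ O ] (Q b b′)))
      ≡⟨ Σ-cong L (λ b → Σ-cong L (λ b′ → Σ-outcomes-∏ m n _)) ⟩
    Σ[ L ] X ∎

^-distribʳ-* : ∀ a b s → (a * b) ^ s ≡ a ^ s * b ^ s
^-distribʳ-* a b zero    = refl
^-distribʳ-* a b (suc s) = trans (cong (a * b *_) (^-distribʳ-* a b s)) (regroup a b (a ^ s) (b ^ s))
  where
  regroup : ∀ a b x y → a * b * (x * y) ≡ a * x * (b * y)
  regroup = solve-∀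

-- Log-concavity of x ↦ x^s at 1+r: r^s (r+2)^s ≤ (r+1)^{2s}, from r (r+2) ≤ (r+1)².
pow-log-concave : ∀ r s → r ^ s * suc (suc r) ^ s ≤ suc r ^ s * suc r ^ s
pow-log-concave r s = begin
  r ^ s * suc (suc r) ^ s ≡⟨ sym (^-distribʳ-* r (suc (suc r)) s) ⟩
  (r * suc (suc r)) ^ s   ≤⟨ ^-monoˡ-≤ s (≤-trans (m≤m+n _ 1) (≤-reflexive (square r))) ⟩
  (suc r * suc r) ^ s     ≡⟨ ^-distribʳ-* (suc r) (suc r) s ⟩
  suc r ^ s * suc r ^ s   ∎
  where
  open ≤-Reasoning
  square : ∀ r → r * suc (suc r) + 1 ≡ suc r * suc r
  square = solve-∀

-- Bernoulli's inequality (1 + 1/a)^s ≥ 1 + s/a, cleared of denominators.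
bernoulli : ∀ a s → a ^ s * (a + s) ≤ suc a ^ s * a
bernoulli a zero    = ≤-reflexive (cong (_+ 0) (+-identityʳ a))
bernoulli a (suc s) = begin
  a * a ^ s * (a + suc s)                ≤⟨ m≤m+n _ (a ^ s * s) ⟩
  a * a ^ s * (a + suc s) + a ^ s * s    ≡⟨ regroup a s (a ^ s) ⟩
  suc a * (a ^ s * (a + s))              ≤⟨ *-monoʳ-≤ (suc a) (bernoulli a s) ⟩
  suc a * (suc a ^ s * a)                ≡⟨ sym (*-assoc (suc a) (suc a ^ s) a) ⟩
  suc a * suc a ^ s * a                  ∎
  where
  open ≤-Reasoning
  regroup : ∀ a s x → a * x * (a + suc s) + x * s ≡ suc a * (x * (a + s))
  regroup = solve-∀

-- (1 - 1/n)^n ≤ 1/2 for n = p + 1 ≥ 2, via Bernoulli with s = n: (1 + 1/p)^{p+1} ≥ 2 + 1/p.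
pow-upper : ∀ p .{{_ : NonZero p}} → 2 * p ^ suc p ≤ suc p ^ suc p
pow-upper p = *-cancelʳ-≤ _ _ p (begin
  2 * A * p          ≡⟨ regroup A p ⟩
  A * (p + p)        ≤⟨ *-monoʳ-≤ A (+-monoʳ-≤ p (n≤1+n p)) ⟩
  A * (p + suc p)    ≤⟨ bernoulli p (suc p) ⟩
  suc p ^ suc p * p  ∎)
  where
  open ≤-Reasoning
  A = p ^ suc p
  regroup : ∀ A p → 2 * A * p ≡ A * (p + p)
  regroup = solve-∀

-- Bernoulli from below: (1 - 1/n)^s ≥ 1 - s/n, i.e. (n - s) n^s ≤ n (n-1)^s, for n = p + 1.
bernoulli-lower : ∀ p s d → d + s ≡ suc p → d * suc p ^ s ≤ suc p * p ^ s
bernoulli-lower p zero    d d≡n = ≤-reflexive (cong (_* 1) (trans (sym (+-identityʳ d)) d≡n))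
bernoulli-lower p (suc s) d d+s≡n = begin
  d * (suc p * suc p ^ s)   ≡⟨ sym (*-assoc d (suc p) _) ⟩
  d * suc p * suc p ^ s     ≤⟨ *-monoˡ-≤ (suc p ^ s) step ⟩
  p * suc d * suc p ^ s     ≡⟨ *-assoc p (suc d) _ ⟩
  p * (suc d * suc p ^ s)   ≤⟨ *-monoʳ-≤ p (bernoulli-lower p s (suc d) (trans (sym (+-suc d s)) d+s≡n)) ⟩
  p * (suc p * p ^ s)       ≡⟨ regroup p (p ^ s) ⟩
  suc p * (p * p ^ s)       ∎
  where
  open ≤-Reasoning
  d≤p : d ≤ p
  d≤p = ≤-pred (≤-trans (s≤s (m≤m+n d s)) (≤-reflexive (trans (sym (+-suc d s)) d+s≡n)))
  expand : ∀ d p → d * suc p + p ≡ d + p * suc d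
  expand = solve-∀
  step : d * suc p ≤ p * suc d
  step = +-cancelʳ-≤ p _ _ (≤-trans (≤-reflexive (expand d p)) (≤-trans (+-monoˡ-≤ (p * suc d) d≤p) (≤-reflexive (+-comm p _))))
  regroup : ∀ p x → p * (suc p * x) ≡ suc p * (p * x)
  regroup = solve-∀

-- Split n = r + 5q and apply bernoulli-lower to each of five blocks of length q
-- and to the remainder: (1 - 1/n)^n ≥ (1 - q/n)^5 (1 - r/n).
five-blocks : ∀ p q r → r + q * 5 ≡ suc p →
              (suc p ∸ q) ^ 5 * (suc p ∸ r) * suc p ^ suc p ≤ suc p ^ 6 * p ^ suc p
five-blocks p q r n≡ = begin
  X ^ 5 * Y * n ^ n                   ≡⟨ cong (X ^ 5 * Y *_) (split n) ⟩
  X ^ 5 * Y * (n ^ r * (n ^ q) ^ 5)   ≡⟨ regroup₁ (X ^ 5) ((n ^ q) ^ 5) Y (n ^ r) ⟩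
  X ^ 5 * (n ^ q) ^ 5 * (Y * n ^ r)   ≡⟨ cong (_* (Y * n ^ r)) (sym (^-distribʳ-* X (n ^ q) 5)) ⟩
  (X * n ^ q) ^ 5 * (Y * n ^ r)       ≤⟨ *-mono-≤ (^-monoˡ-≤ 5 block) rest ⟩
  (n * p ^ q) ^ 5 * (n * p ^ r)       ≡⟨ cong (_* (n * p ^ r)) (^-distribʳ-* n (p ^ q) 5) ⟩
  n ^ 5 * (p ^ q) ^ 5 * (n * p ^ r)   ≡⟨ regroup₂ (n ^ 5) ((p ^ q) ^ 5) n (p ^ r) ⟩
  n ^ 6 * (p ^ r * (p ^ q) ^ 5)       ≡⟨ cong (n ^ 6 *_) (sym (split p)) ⟩
  n ^ 6 * p ^ n                       ∎
  where
  open ≤-Reasoning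
  n = suc p
  X = n ∸ q
  Y = n ∸ r
  q≤n : q ≤ n
  q≤n = ≤-trans (m≤m*n q 5) (≤-trans (m≤n+m (q * 5) r) (≤-reflexive n≡))
  r≤n : r ≤ n
  r≤n = ≤-trans (m≤m+n r (q * 5)) (≤-reflexive n≡)
  block : X * n ^ q ≤ n * p ^ q
  block = bernoulli-lower p q X (m∸n+n≡m q≤n)
  rest : Y * n ^ r ≤ n * p ^ r
  rest = bernoulli-lower p r Y (m∸n+n≡m r≤n)
  split : ∀ x → x ^ n ≡ x ^ r * (x ^ q) ^ 5
  split x = trans (cong (x ^_) (sym n≡)) (trans (^-distribˡ-+-* x r (q * 5)) (cong (x ^ r *_) (sym (^-*-assoc x q 5))))
  regroup₁ : ∀ X5 N5 Y nr → X5 * Y * (nr * N5) ≡ X5 * N5 * (Y * nr)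
  regroup₁ = solve-∀
  regroup₂ : ∀ N5 P5 n pr → N5 * P5 * (n * pr) ≡ (n * N5) * (pr * P5)
  regroup₂ = solve-∀

-- For n ≥ 100: 96875 n ≤ 102400 (n - 4), i.e. (4/5)^5 (1 - 4/n) ≥ 31/100.
linear-for-100 : ∀ n → 100 ≤ n → 96875 * n ≤ 102400 * (n ∸ 4)
linear-for-100 n 100≤n = subst (λ x → 96875 * x ≤ 102400 * (x ∸ 4)) (m+[n∸m]≡n 100≤n) (from100 (n ∸ 100))
  where
  identity : ∀ j → 96875 * (100 + j) + (142900 + 5525 * j) ≡ 102400 * (96 + j)
  identity = solve-∀
  from100 : ∀ j → 96875 * (100 + j) ≤ 102400 * ((100 + j) ∸ 4)
  from100 j = ≤-trans (m≤m+n _ (142900 + 5525 * j)) (≤-reflexive (identity j))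

-- With q = ⌊n/5⌋ we have 5q ≤ n, so 4n ≤ 5 (n - q) and (4n)^5 ≤ (5 (n - q))^5.
fifth-power-bound : ∀ n → 1024 * n ^ 5 ≤ 3125 * (n ∸ n / 5) ^ 5
fifth-power-bound n = begin
  1024 * n ^ 5   ≡⟨ sym (^-distribʳ-* 4 n 5) ⟩
  (4 * n) ^ 5    ≤⟨ ^-monoˡ-≤ 5 four-fifths ⟩
  (5 * X) ^ 5    ≡⟨ ^-distribʳ-* 5 X 5 ⟩
  3125 * X ^ 5   ∎
  where
  open ≤-Reasoning
  q = n / 5
  X = n ∸ q
  q*5≤n : q * 5 ≤ n
  q*5≤n = m/n*n≤m n 5
  regroup₁ : ∀ n → 4 * n + n ≡ 5 * n
  regroup₁ = solve-∀
  regroup₂ : ∀ X q → 5 * (X + q) ≡ 5 * X + q * 5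
  regroup₂ = solve-∀
  four-fifths : 4 * n ≤ 5 * X
  four-fifths = +-cancelʳ-≤ (q * 5) _ _ (begin
    4 * n + q * 5   ≤⟨ +-monoʳ-≤ (4 * n) q*5≤n ⟩
    4 * n + n       ≡⟨ regroup₁ n ⟩
    5 * n           ≡⟨ cong (5 *_) (sym (m∸n+n≡m (≤-trans (m≤m*n q 5) q*5≤n))) ⟩
    5 * (X + q)     ≡⟨ regroup₂ X q ⟩
    5 * X + q * 5   ∎)

-- Stated for an
-- arbitrary n (rather than n = p + 1) so that the typechecker never unfolds its powers.
lower-from-blocks : ∀ n X Y A .{{_ : NonZero n}} → 96875 * n ≤ 102400 * Y →
                    1024 * n ^ 5 ≤ 3125 * X ^ 5 → X ^ 5 * Y * n ^ n ≤ n ^ 6 * A → 31 * n ^ n ≤ 100 * A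
lower-from-blocks n X Y A linear fifth blocks = *-cancelˡ-≤ (n * K) {{m^n≢0 n 6}} (*-cancelˡ-≤ 3125 (begin
  3125 * (n * K * (31 * T))        ≡⟨ regroup₁ 3125 31 n K T ⟩
  3125 * 31 * n * K * T            ≤⟨ *-monoˡ-≤ T (*-monoˡ-≤ K linear) ⟩
  102400 * Y * K * T               ≡⟨ regroup₂ 100 1024 Y K T ⟩
  100 * Y * (1024 * K) * T         ≤⟨ *-monoˡ-≤ T (*-monoʳ-≤ (100 * Y) fifth) ⟩
  100 * Y * (3125 * X ^ 5) * T     ≡⟨ regroup₃ 3125 100 Y (X ^ 5) T ⟩
  3125 * (100 * (X ^ 5 * Y * T))   ≤⟨ *-monoʳ-≤ 3125 (*-monoʳ-≤ 100 blocks′) ⟩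
  3125 * (100 * (n * K * A))       ≡⟨ cong (3125 *_) (regroup₄ 100 (n * K) A) ⟩
  3125 * (n * K * (100 * A))       ∎))
  where
  open ≤-Reasoning
  T = n ^ n
  K = n ^ 5
  blocks′ : X ^ 5 * Y * T ≤ n * K * A
  blocks′ = blocks
  regroup₁ : ∀ c d n K T → c * (n * K * (d * T)) ≡ c * d * n * K * T
  regroup₁ = solve-∀
  regroup₂ : ∀ c d Y K T → c * d * Y * K * T ≡ c * Y * (d * K) * T
  regroup₂ = solve-∀
  regroup₃ : ∀ c d Y X5 T → d * Y * (c * X5) * T ≡ c * (d * (X5 * Y * T))
  regroup₃ = solve-∀
  regroup₄ : ∀ c N A → c * (N * A) ≡ N * (c * A)
  regroup₄ = solve-∀

-- (1 - 1/n)^n ≥ 31/100 for n = p + 1 ≥ 100: five-blocks with q = ⌊n/5⌋ and r = n mod 5 ≤ 4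
-- gives (1 - 1/n)^n ≥ (4/5)^5 (1 - 4/n), and (4/5)^5 (1 - 4/100) ≥ 31/100.
pow-lower : ∀ p → 100 ≤ suc p → 31 * suc p ^ suc p ≤ 100 * p ^ suc p
pow-lower p 100≤n = lower-from-blocks n (n ∸ q) (n ∸ r) (p ^ n)
  (≤-trans (linear-for-100 n 100≤n) (*-monoʳ-≤ 102400 (∸-monoʳ-≤ n r≤4)))
  (fifth-power-bound n)
  (five-blocks p q r (sym (m≡m%n+[m/n]*n n 5)))
  where
  n = suc p
  q = n / 5
  r = n % 5
  r≤4 : r ≤ 4
  r≤4 = ≤-pred (m%n<n n 5)

-- The quadratic inequality below after the substitution T = 2A + w:
-- if 38A = 31w + u, then 50A² + 26T² ≤ 100AT.  Scaled by 38², both sides become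
-- polynomials in w, u whose difference has nonnegative coefficients.
quadratic-core : ∀ A w u → 38 * A ≡ 31 * w + u →
                 50 * A * A + 26 * (2 * A + w) * (2 * A + w) ≤ 100 * A * (2 * A + w)
quadratic-core A w u 38A≡ = *-cancelˡ-≤ 1444 (begin
  1444 * (50 * A * A + 26 * (2 * A + w) * (2 * A + w))   ≡⟨ scale₁ A w ⟩
  lhs (38 * A)                                           ≡⟨ cong lhs 38A≡ ⟩
  lhs (31 * w + u)                                       ≤⟨ m≤m+n _ _ ⟩
  lhs (31 * w + u) + (1950 * w * w + 2700 * w * u + 46 * u * u) ≡⟨ remainder w u ⟩
  rhs (31 * w + u)                                       ≡⟨ cong rhs (sym 38A≡) ⟩
  rhs (38 * A)                                           ≡⟨ scale₂ A w ⟩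
  1444 * (100 * A * (2 * A + w))                         ∎)
  where
  open ≤-Reasoning
  lhs rhs : ℕ → ℕ
  lhs a = 50 * a * a + 26 * (2 * a + 38 * w) * (2 * a + 38 * w)
  rhs a = 100 * a * (2 * a + 38 * w)
  scale₁ : ∀ A w → 1444 * (50 * A * A + 26 * (2 * A + w) * (2 * A + w))
                   ≡ 50 * (38 * A) * (38 * A) + 26 * (2 * (38 * A) + 38 * w) * (2 * (38 * A) + 38 * w)
  scale₁ = solve-∀
  remainder : ∀ w u → 50 * (31 * w + u) * (31 * w + u) + 26 * (2 * (31 * w + u) + 38 * w) * (2 * (31 * w + u) + 38 * w)
                        + (1950 * w * w + 2700 * w * u + 46 * u * u)
                      ≡ 100 * (31 * w + u) * (2 * (31 * w + u) + 38 * w)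
  remainder = solve-∀
  scale₂ : ∀ A w → 100 * (38 * A) * (2 * (38 * A) + 38 * w) ≡ 1444 * (100 * A * (2 * A + w))
  scale₂ = solve-∀

-- With a = A/T ∈ [0.31, 0.5]:  50a² + 26 ≤ 100a  (the roots of 50a² - 100a + 26 are
-- ≈ 0.307 and ≈ 1.69).  Apply quadratic-core with w = T - 2A and u = 100A - 31T.
quadratic-window : ∀ A T → 2 * A ≤ T → 31 * T ≤ 100 * A → 50 * A * A + 26 * T * T ≤ 100 * A * T
quadratic-window A T 2A≤T 31T≤100A =
  subst (λ t → 50 * A * A + 26 * t * t ≤ 100 * A * t) (m+[n∸m]≡n 2A≤T) (quadratic-core A w u 38A≡)
  where
  open ≡-Reasoning
  w = T ∸ 2 * A
  u = 100 * A ∸ 31 * T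
  split₁ : ∀ A → 100 * A ≡ 62 * A + 38 * A
  split₁ = solve-∀
  split₂ : ∀ A w u → 31 * (2 * A + w) + u ≡ 62 * A + (31 * w + u)
  split₂ = solve-∀
  38A≡ : 38 * A ≡ 31 * w + u
  38A≡ = +-cancelˡ-≡ (62 * A) _ _ (begin
    62 * A + 38 * A      ≡⟨ sym (split₁ A) ⟩
    100 * A              ≡⟨ sym (m+[n∸m]≡n 31T≤100A) ⟩
    31 * T + u           ≡⟨ cong (λ t → 31 * t + u) (sym (m+[n∸m]≡n 2A≤T)) ⟩
    31 * (2 * A + w) + u ≡⟨ split₂ A w u ⟩
    62 * A + (31 * w + u) ∎)

-- With a = A/T, b = B/T ≤ a² and p ≥ 25:  2a + p(2b + 1) ≤ 4pa.
-- From the window inequality, 2a + p(2a² + 1) ≤ 4pa, using 2a ≤ 1 ≤ p/25.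
linear-in-p : ∀ p A B T .{{_ : NonZero T}} → 25 ≤ p → 2 * A ≤ T → B * T ≤ A * A →
              50 * A * A + 26 * T * T ≤ 100 * A * T → 2 * A + p * (2 * B + T) ≤ 4 * p * A
linear-in-p p A B T 25≤p 2A≤T BT≤AA window = *-cancelʳ-≤ _ _ T (*-cancelˡ-≤ 25 (begin
  25 * ((2 * A + p * (2 * B + T)) * T)                ≡⟨ expand₁ A B T p ⟩
  25 * (2 * A) * T + p * (50 * (B * T) + 25 * T * T)  ≤⟨ +-mono-≤ (*-monoˡ-≤ T (*-monoʳ-≤ 25 2A≤T))
                                                          (*-monoʳ-≤ p (+-monoˡ-≤ _ (*-monoʳ-≤ 50 BT≤AA))) ⟩
  25 * T * T + p * (50 * (A * A) + 25 * T * T)        ≤⟨ +-monoˡ-≤ _ (*-monoˡ-≤ T (*-monoˡ-≤ T 25≤p)) ⟩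
  p * T * T + p * (50 * (A * A) + 25 * T * T)         ≡⟨ expand₂ A T p ⟩
  p * (50 * A * A + 26 * T * T)                       ≤⟨ *-monoʳ-≤ p window ⟩
  p * (100 * A * T)                                   ≡⟨ expand₃ A T p ⟩
  25 * (4 * p * A * T)                                ∎))
  where
  open ≤-Reasoning
  expand₁ : ∀ A B T p → 25 * ((2 * A + p * (2 * B + T)) * T) ≡ 25 * (2 * A) * T + p * (50 * (B * T) + 25 * T * T)
  expand₁ = solve-∀
  expand₂ : ∀ A T p → p * T * T + p * (50 * (A * A) + 25 * T * T) ≡ p * (50 * A * A + 26 * T * T)
  expand₂ = solve-∀
  expand₃ : ∀ A T p → p * (100 * A * T) ≡ 25 * (4 * p * A * T)
  expand₃ = solve-∀

-- With 2m ≥ p and T ≤ 4A (i.e. a ≥ 1/4):  pb + a + m ≤ 4ma, obtained from linear-in-p by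
-- adding (2m - p)·1 ≤ (2m - p)·4a and halving.
linear-in-m : ∀ p m A B T → p ≤ 2 * m → T ≤ 4 * A → 2 * A + p * (2 * B + T) ≤ 4 * p * A →
                    p * B + A + m * T ≤ 4 * m * A
linear-in-m p m A B T p≤2m T≤4A linear = *-cancelˡ-≤ 2 (begin
  2 * (p * B + A + m * T)             ≡⟨ expand₁ p B A m T ⟩
  2 * A + 2 * p * B + (2 * m) * T     ≡⟨ cong (λ z → 2 * A + 2 * p * B + z * T) 2m≡ ⟩
  2 * A + 2 * p * B + (p + e) * T     ≡⟨ expand₂ p B A e T ⟩
  2 * A + p * (2 * B + T) + e * T     ≤⟨ +-mono-≤ linear (*-monoʳ-≤ e T≤4A) ⟩
  4 * p * A + e * (4 * A)             ≡⟨ expand₃ p A e ⟩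
  4 * (p + e) * A                     ≡⟨ cong (λ z → 4 * z * A) (sym 2m≡) ⟩
  4 * (2 * m) * A                     ≡⟨ expand₄ m A ⟩
  2 * (4 * m * A)                     ∎)
  where
  open ≤-Reasoning
  e = 2 * m ∸ p
  2m≡ : 2 * m ≡ p + e
  2m≡ = sym (m+[n∸m]≡n p≤2m)
  expand₁ : ∀ p B A m T → 2 * (p * B + A + m * T) ≡ 2 * A + 2 * p * B + (2 * m) * T
  expand₁ = solve-∀
  expand₂ : ∀ p B A e T → 2 * A + 2 * p * B + (p + e) * T ≡ 2 * A + p * (2 * B + T) + e * T
  expand₂ = solve-∀
  expand₃ : ∀ p A e → 4 * p * A + e * (4 * A) ≡ 4 * (p + e) * A
  expand₃ = solve-∀
  expand₄ : ∀ m A → 4 * (2 * m) * A ≡ 2 * (4 * m * A)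
  expand₄ = solve-∀

-- The moment inequality behind E[min(m, Z)] ≥ m/2: for n ≥ 100 and n - 1 ≤ 2m ≤ n,
-- any S₂ with the value of n^n E[Z²] from second-moment satisfies
-- S₂ + 2m² n^n ≤ 4m · n (n-1)^n, i.e. E[Z²] + 2m² ≤ 4m E[Z].
moment-inequality : ∀ n → 100 ≤ n → ∀ m → 2 * m ≤ n → n ≤ suc (2 * m) → ∀ S₂ →
                    S₂ + n * (n ∸ 2) ^ n ≡ n * (n * (n ∸ 2) ^ n + (n ∸ 1) ^ n) →
                    S₂ + 2 * m * m * n ^ n ≤ 4 * m * (n * (n ∸ 1) ^ n)
moment-inequality zero          ()
moment-inequality (suc zero)    (s≤s ())
moment-inequality (suc (suc r)) 100≤n m 2m≤n n≤2m+1 S₂ S₂-moment = begin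
  S₂ + 2 * m * m * T                  ≡⟨ cong₂ _+_ S₂≡ (regroup₁ m T) ⟩
  n * (p * B + A) + m * (2 * m) * T   ≤⟨ +-monoʳ-≤ (n * (p * B + A)) (*-monoˡ-≤ T (*-monoʳ-≤ m 2m≤n)) ⟩
  n * (p * B + A) + m * n * T         ≡⟨ regroup₂ n p B A m T ⟩
  n * (p * B + A + m * T)             ≤⟨ *-monoʳ-≤ n (linear-in-m p m A B T (≤-pred n≤2m+1) T≤4A linear) ⟩
  n * (4 * m * A)                     ≡⟨ regroup₃ n m A ⟩
  4 * m * (n * A)                     ∎
  where
  open ≤-Reasoning
  p = suc r
  n = suc p
  A = p ^ n
  B = r ^ n
  T = n ^ n
  31T≤100A : 31 * T ≤ 100 * A
  31T≤100A = pow-lower p 100≤n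
  T≤4A : T ≤ 4 * A
  T≤4A = *-cancelˡ-≤ 31 (≤-trans 31T≤100A (≤-trans (*-monoˡ-≤ A (m≤m+n 100 24)) (≤-reflexive (*-assoc 31 4 A))))
  linear : 2 * A + p * (2 * B + T) ≤ 4 * p * A
  linear = linear-in-p p A B T {{m^n≢0 n n}} (≤-pred (≤-trans (m≤m+n 26 74) 100≤n)) (pow-upper p)
             (pow-log-concave r n) (quadratic-window A T (pow-upper p) 31T≤100A)
  split : ∀ p B A → suc p * (suc p * B + A) ≡ suc p * (p * B + A) + suc p * B
  split = solve-∀
  S₂≡ : S₂ ≡ n * (p * B + A)
  S₂≡ = +-cancelʳ-≡ (n * B) _ _ (trans S₂-moment (split p B A))
  regroup₁ : ∀ m T → 2 * m * m * T ≡ m * (2 * m) * T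
  regroup₁ = solve-∀
  regroup₂ : ∀ n p B A m T → n * (p * B + A) + m * n * T ≡ n * (p * B + A + m * T)
  regroup₂ = solve-∀
  regroup₃ : ∀ n m A → n * (4 * m * A) ≡ 4 * m * (n * A)
  regroup₃ = solve-∀

min-rescale : ∀ k m z → k ≤ m → k * (m ⊓ z) ≤ m * (k ⊓ z)
min-rescale k m z k≤m with ≤-total z k
... | inj₁ z≤k = begin
  k * (m ⊓ z) ≡⟨ cong (k *_) (m≥n⇒m⊓n≡n (≤-trans z≤k k≤m)) ⟩
  k * z       ≤⟨ *-monoˡ-≤ z k≤m ⟩
  m * z       ≡⟨ cong (m *_) (sym (m≥n⇒m⊓n≡n z≤k)) ⟩
  m * (k ⊓ z) ∎
  where open ≤-Reasoning
... | inj₂ k≤z = begin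
  k * (m ⊓ z) ≤⟨ *-monoʳ-≤ k (m⊓n≤m m z) ⟩
  k * m       ≡⟨ *-comm k m ⟩
  m * k       ≡⟨ cong (m *_) (sym (m≤n⇒m⊓n≡m k≤z)) ⟩
  m * (k ⊓ z) ∎
  where open ≤-Reasoning

am-gm : ∀ a b → 2 * a * b ≤ a * a + b * b
am-gm a b with ≤-total a b
... | inj₁ a≤b = subst (λ x → 2 * a * x ≤ a * a + x * x) (m+[n∸m]≡n a≤b) (≤-trans (m≤m+n _ _) (≤-reflexive (square a (b ∸ a))))
  where
  square : ∀ a d → 2 * a * (a + d) + d * d ≡ a * a + (a + d) * (a + d)
  square = solve-∀
... | inj₂ b≤a = subst (λ x → 2 * x * b ≤ x * x + b * b) (m+[n∸m]≡n b≤a) (≤-trans (m≤m+n _ _) (≤-reflexive (square b (a ∸ b))))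
  where
  square : ∀ b d → 2 * (b + d) * b + d * d ≡ (b + d) * (b + d) + b * b
  square = solve-∀

min-quadratic : ∀ m z → 4 * m * z ≤ 4 * m * (m ⊓ z) + z * z
min-quadratic m z with ≤-total z m
... | inj₁ z≤m = ≤-trans (m≤m+n _ _) (≤-reflexive (cong (λ x → 4 * m * x + z * z) (sym (m≥n⇒m⊓n≡n z≤m))))
... | inj₂ m≤z = begin
  4 * m * z               ≡⟨ regroup₁ m z ⟩
  2 * (2 * m) * z         ≤⟨ am-gm (2 * m) z ⟩
  2 * m * (2 * m) + z * z ≡⟨ cong (_+ z * z) (regroup₂ m) ⟩
  4 * m * m + z * z       ≡⟨ cong (λ x → 4 * m * x + z * z) (sym (m≤n⇒m⊓n≡m m≤z)) ⟩
  4 * m * (m ⊓ z) + z * z ∎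
  where
  open ≤-Reasoning
  regroup₁ : ∀ m z → 4 * m * z ≡ 2 * (2 * m) * z
  regroup₁ = solve-∀
  regroup₂ : ∀ m → 2 * m * (2 * m) ≡ 4 * m * m
  regroup₂ = solve-∀

-- E[min(m, Z)] ≥ m/2 for n ≥ 100 and n - 1 ≤ 2m ≤ n: sum min-quadratic over all outcomes,
-- insert the two moments and apply the moment inequality.
truncated-mean : ∀ n → 100 ≤ n → ∀ m → 2 * m ≤ n → n ≤ suc (2 * m) →
                 m * n ^ n ≤ 2 * Σ[ allOutcomes n n ] (λ v → m ⊓ emptyBins v)
truncated-mean _ _      zero      _    _      = z≤n
truncated-mean n 100≤n m@(suc _) 2m≤n n≤2m+1 = *-cancelˡ-≤ 2 (*-cancelˡ-≤ m (begin
  m * (2 * (m * T))     ≡⟨ regroup₁ m T ⟩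
  2 * m * m * T         ≤⟨ +-cancelˡ-≤ S₂ _ _ bound ⟩
  4 * m * SW            ≡⟨ regroup₂ m SW ⟩
  m * (2 * (2 * SW))    ∎))
  where
  open ≤-Reasoning
  O = allOutcomes n n
  T = n ^ n
  SW = Σ[ O ] (λ v → m ⊓ emptyBins v)
  S₂ = Σ[ O ] (λ v → emptyBins v * emptyBins v)
  summed : 4 * m * Σ[ O ] emptyBins ≤ 4 * m * SW + S₂
  summed = begin
    4 * m * Σ[ O ] emptyBins                          ≡⟨ sym (Σ-*ˡ O (4 * m) emptyBins) ⟩
    Σ[ O ] (λ v → 4 * m * emptyBins v)                ≤⟨ Σ-mono O (λ v → min-quadratic m (emptyBins v)) ⟩
    Σ[ O ] (λ v → 4 * m * (m ⊓ emptyBins v) + emptyBins v * emptyBins v) ≡⟨ Σ-+ O _ _ ⟩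
    Σ[ O ] (λ v → 4 * m * (m ⊓ emptyBins v)) + S₂     ≡⟨ cong (_+ S₂) (Σ-*ˡ O (4 * m) _) ⟩
    4 * m * SW + S₂                                   ∎
  bound : S₂ + 2 * m * m * T ≤ S₂ + 4 * m * SW
  bound = begin
    S₂ + 2 * m * m * T              ≤⟨ moment-inequality n 100≤n m 2m≤n n≤2m+1 S₂ (second-moment n n) ⟩
    4 * m * (n * (n ∸ 1) ^ n)       ≡⟨ cong (4 * m *_) (sym (first-moment n n)) ⟩
    4 * m * Σ[ O ] emptyBins        ≤⟨ summed ⟩
    4 * m * SW + S₂                 ≡⟨ +-comm _ S₂ ⟩
    S₂ + 4 * m * SW                 ∎
  regroup₁ : ∀ m T → m * (2 * (m * T)) ≡ 2 * m * m * T
  regroup₁ = solve-∀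
  regroup₂ : ∀ m W → 4 * m * W ≡ m * (2 * (2 * W))
  regroup₂ = solve-∀

half-lower : ∀ n → 2 * ⌊ n /2⌋ ≤ n
half-lower zero          = z≤n
half-lower (suc zero)    = z≤n
half-lower (suc (suc n)) = s≤s (subst (_≤ suc n) (sym (+-suc h (h + 0))) (s≤s (half-lower n)))
  where h = ⌊ n /2⌋

half-upper : ∀ n → n ≤ suc (2 * ⌊ n /2⌋)
half-upper zero          = z≤n
half-upper (suc zero)    = s≤s z≤n
half-upper (suc (suc n)) = s≤s (subst (suc n ≤_) (cong suc (sym (+-suc h (h + 0)))) (s≤s (half-upper n)))
  where h = ⌊ n /2⌋

half-greatest : ∀ n k → k + k ≤ n → k ≤ ⌊ n /2⌋
half-greatest n k k+k≤n = subst (_≤ ⌊ n /2⌋) (sym (n≡⌊n+n/2⌋ k)) (⌊n/2⌋-mono k+k≤n)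

-- Averaging the deterministic bound: for k ≤ m and 2k ≤ n,
-- k·m·n^n + k·Σ min(m, Z) ≤ m·Σ N_k, since pointwise
-- k·m + k·min(m, Z) ≤ m·(k + min(k, Z)) ≤ m·N_k.
top-load-sum : ∀ n k m → k + k ≤ n → k ≤ m →
               k * m * n ^ n + k * Σ[ allOutcomes n n ] (λ v → m ⊓ emptyBins v) ≤ m * totalTopLoad n k
top-load-sum n k m k+k≤n k≤m = begin
  k * m * n ^ n + k * Σ[ O ] W                    ≡⟨ sym (cong₂ _+_ (Σ-outcomes-const n n (k * m)) (Σ-*ˡ O k W)) ⟩
  Σ[ O ] (λ _ → k * m) + Σ[ O ] (λ v → k * W v)   ≡⟨ sym (Σ-+ O _ _) ⟩
  Σ[ O ] (λ v → k * m + k * W v)                  ≤⟨ Σ-mono O pointwise ⟩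
  Σ[ O ] (λ v → m * topLoad k v)                  ≡⟨ Σ-*ˡ O m (topLoad k) ⟩
  m * totalTopLoad n k                            ∎
  where
  open ≤-Reasoning
  O = allOutcomes n n
  W = λ v → m ⊓ emptyBins v
  pointwise : ∀ v → k * m + k * W v ≤ m * topLoad k v
  pointwise v = begin
    k * m + k * (m ⊓ emptyBins v) ≤⟨ +-mono-≤ (≤-reflexive (*-comm k m)) (min-rescale k m (emptyBins v) k≤m) ⟩
    m * k + m * (k ⊓ emptyBins v) ≡⟨ sym (*-distribˡ-+ m k _) ⟩
    m * (k + k ⊓ emptyBins v)     ≤⟨ *-monoʳ-≤ m (topLoad-bound v k k+k≤n) ⟩
    m * topLoad k v               ∎

lemma6 : ∃[ n₀ ] ((n : ℕ) → n₀ ≤ n → (k : ℕ) → 1 ≤ k → 2 * k ≤ n → 3 * k * n ^ n ≤ 2 * totalTopLoad n k)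
lemma6 = 100 , bound
  where
  bound : (n : ℕ) → 100 ≤ n → (k : ℕ) → 1 ≤ k → 2 * k ≤ n → 3 * k * n ^ n ≤ 2 * totalTopLoad n k
  bound n 100≤n k 1≤k 2k≤n = *-cancelˡ-≤ m {{>-nonZero (≤-trans 1≤k k≤m)}} (begin
    m * (3 * k * T)                     ≡⟨ regroup₁ m k T ⟩
    2 * (k * m * T) + k * (m * T)       ≤⟨ +-monoʳ-≤ _ (*-monoʳ-≤ k (truncated-mean n 100≤n m (half-lower n) (half-upper n))) ⟩
    2 * (k * m * T) + k * (2 * SW)      ≡⟨ regroup₂ k m T SW ⟩
    2 * (k * m * T + k * SW)            ≤⟨ *-monoʳ-≤ 2 (top-load-sum n k m k+k≤n k≤m) ⟩
    2 * (m * totalTopLoad n k)          ≡⟨ regroup₃ m (totalTopLoad n k) ⟩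
    m * (2 * totalTopLoad n k)          ∎)
    where
    open ≤-Reasoning
    m = ⌊ n /2⌋
    T = n ^ n
    SW = Σ[ allOutcomes n n ] (λ v → m ⊓ emptyBins v)
    k+k≤n : k + k ≤ n
    k+k≤n = subst (_≤ n) (cong (k +_) (+-identityʳ k)) 2k≤n
    k≤m : k ≤ m
    k≤m = half-greatest n k k+k≤n
    regroup₁ : ∀ m k T → m * (3 * k * T) ≡ 2 * (k * m * T) + k * (m * T)
    regroup₁ = solve-∀
    regroup₂ : ∀ k m T W → 2 * (k * m * T) + k * (2 * W) ≡ 2 * (k * m * T + k * W)
    regroup₂ = solve-∀
    regroup₃ : ∀ m S → 2 * (m * S) ≡ m * (2 * S)
    regroup₃ = solve-∀
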